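{- Let $(a,b,c,d)=(y_{1,0},y_{2,0},y_{3,0},y_{4,0})$ be the first diagonal of an arithmetic Y-frieze pattern of width $4$. Then one of the following holds: (1) $a\le 5$, $b\le 102$, $c\le 168$, $d\le 41$; (2) $a\le 5$, $b\le 168$, $c\le 102$, $d\le 41$; (3) $a\le 41$, $b\le 102$, $c\le 168$, $d\le 5$; (4) $a\le 41$, $b\le 168$, $c\le 102$, $d\le 5$.
   Context: A Y-frieze pattern of width $n$ is an array of rational numbers $y_{i,j}$, $i=0,1,\dots,n+1$, $j\in\mathbb{Z}$, arranged in staggered rows (entry $y_{i,j}$ placed at horizontal position $j+i/2$ in row $i$), such that row $0$ and row $n+1$ consist entirely of $0$'s, no row strictly between them consists entirely of $0$'s, and the Y-diamond rule $WE=(1+N)(1+S)$ holds for every diamond, i.e. $y_{i,j}\,y_{i,j+1}=(1+y_{i-1,j+1})(1+y_{i+1,j})$ for $1\le i\le n$, $j\in\mathbb{Z}$. It is arithmetic if all entries in rows $1,\dots,n$ (its non-zero entries) are positive integers. The first diagonal is $(y_{1,0},\dots,y_{n,0})$. -}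

module Defs where

open import Data.Nat as ℕ using (ℕ; suc; NonZero)
open import Data.Integer as ℤ using (ℤ)
open import Data.Rational using (ℚ; 0ℚ; 1ℚ; _+_; _*_; _/_)
open import Data.Product using (Σ; ∃; _×_)
open import Relation.Binary.PropositionalEquality using (_≡_)
open import Relation.Nullary using (¬_)

-- A Y-frieze pattern of width n: an array y i j of rationals,
-- i = 0,…,n+1 (values at other i are irrelevant), j ∈ ℤ.
record IsYFrieze (n : ℕ) (y : ℕ → ℤ → ℚ) : Set where
  field
    row0     : ∀ j → y 0 j ≡ 0ℚ
    rowTop   : ∀ j → y (suc n) j ≡ 0ℚ
    nonzero  : ∀ i → 1 ℕ.≤ i → i ℕ.≤ n → ¬ (∀ j → y i j ≡ 0ℚ)
    diamond  : ∀ i j → 1 ℕ.≤ i → i ℕ.≤ n →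
               y i j * y i (j ℤ.+ ℤ.1ℤ)
                 ≡ (1ℚ + y (ℕ.pred i) (j ℤ.+ ℤ.1ℤ)) * (1ℚ + y (suc i) j)

record IsArithmeticYFrieze (n : ℕ) (y : ℕ → ℤ → ℚ) : Set where
  field
    isYFrieze : IsYFrieze n y
    positiveInteger : ∀ i j → 1 ℕ.≤ i → i ℕ.≤ n →
                      Σ ℕ (λ m → (1 ℕ.≤ m) × (y i j ≡ (ℤ.+ m) / 1))

-- Write u, v, w, z for rows 1–4.  On each diamond the rule bounds one row by the next:
-- from z₀ z₁ = 1 + w₁ and w₀ w₁ = (1 + v₁)(1 + z₀) one gets w₀ ≤ 3(1 + v₁), then
-- v₀ ≤ 7(1 + u₁) and finally u₀ u₁ = 1 + v₀ ≤ 15 u₁.  So every entry of the first row,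
-- and by reflection of the last row, is at most 15.  The diagonal (a, b, c, d) is then
-- determined by a, d and their neighbours u₁, z₋₁ via b = a u₁ − 1, c = z₋₁ d − 1, and
-- integrality of u₂, z₋₂, w₁ and v₋₁ leaves only the patterns listed, which an
-- exhaustive search over the 15⁴ choices confirms.
module Submission where

open import Defs
open import Data.Nat
  using (ℕ; zero; suc; pred; _+_; _*_; _≤_; _<_; _≤?_; z≤n; s≤s; NonZero)
open import Data.Nat.Properties
  using ( *-comm; *-assoc; *-identityˡ; *-identityʳ; *-zeroʳ; *-cancelʳ-≤; *-monoʳ-≤; m≤m*n; m≤m+n
        ; ≤-trans; ≤-reflexive; ≤-antisym; ≰⇒>; pred[n]≤n; m≤n⇒m≤1+n; 0≢1+n; ≤ᵇ⇒≤; allUpTo?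
        ; module ≤-Reasoning)
open import Data.Nat.Divisibility using (_∣_; _∣?_; divides; *-monoˡ-∣)
open import Data.Nat.Tactic.RingSolver using (solve-∀)
open import Data.Integer using (ℤ; +_; -[1+_])
import Data.Integer as ℤ
import Data.Integer.Properties as ℤ
open import Data.Rational using (ℚ; 1ℚ; _/_; toℚᵘ)
import Data.Rational as ℚ
open import Data.Rational.Properties
  using (toℚᵘ-injective; fromℚᵘ-injective; toℚᵘ-fromℚᵘ; toℚᵘ-homo-+; toℚᵘ-homo-*)
open import Data.Rational.Unnormalised using (ℚᵘ; mkℚᵘ; *≡*) renaming (_≃_ to _≃ᵘ_)
import Data.Rational.Unnormalised as ℚᵘ
import Data.Rational.Unnormalised.Properties as ℚᵘ
open import Data.Product using (_×_; _,_; proj₁; proj₂)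
open import Data.Sum using (_⊎_)
open import Relation.Nullary using (Dec; yes; no; contradiction)
open import Relation.Nullary.Decidable using (_×-dec_; _⊎-dec_; _→-dec_; toWitness)
open import Relation.Binary.PropositionalEquality
  using (_≡_; refl; sym; trans; cong; cong₂; subst; module ≡-Reasoning)

ι : ℕ → ℚ
ι m = + m / 1

ιᵘ : ℕ → ℚᵘ
ιᵘ m = mkℚᵘ (+ m) 0

toℚᵘ-ι : ∀ m → toℚᵘ (ι m) ≃ᵘ ιᵘ m
toℚᵘ-ι m = toℚᵘ-fromℚᵘ (ιᵘ m)

ι-injective : ∀ {m n} → ι m ≡ ι n → m ≡ n
ι-injective {m} {n} eq with *≡* +m*1≡+n*1 ← fromℚᵘ-injective {ιᵘ m} {ιᵘ n} eq =
  ℤ.+-injective (trans (sym (ℤ.*-identityʳ (+ m))) (trans +m*1≡+n*1 (ℤ.*-identityʳ (+ n))))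

ιᵘ-homo-+ : ∀ m n → ιᵘ (m + n) ≃ᵘ ιᵘ m ℚᵘ.+ ιᵘ n
ιᵘ-homo-+ m n = *≡* (cong (ℤ._* + 1) (trans (ℤ.pos-+ m n)
  (sym (cong₂ ℤ._+_ (ℤ.*-identityʳ (+ m)) (ℤ.*-identityʳ (+ n))))))

ιᵘ-homo-* : ∀ m n → ιᵘ (m * n) ≃ᵘ ιᵘ m ℚᵘ.* ιᵘ n
ιᵘ-homo-* m n = *≡* (cong (ℤ._* + 1) (ℤ.pos-* m n))

ι-homo-+ : ∀ m n → ι (m + n) ≡ ι m ℚ.+ ι n
ι-homo-+ m n = toℚᵘ-injective (begin
  toℚᵘ (ι (m + n))              ≈⟨ toℚᵘ-ι (m + n) ⟩
  ιᵘ (m + n)                    ≈⟨ ιᵘ-homo-+ m n ⟩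
  ιᵘ m ℚᵘ.+ ιᵘ n                ≈⟨ ℚᵘ.+-cong (toℚᵘ-ι m) (toℚᵘ-ι n) ⟨
  toℚᵘ (ι m) ℚᵘ.+ toℚᵘ (ι n)    ≈⟨ toℚᵘ-homo-+ (ι m) (ι n) ⟨
  toℚᵘ (ι m ℚ.+ ι n)            ∎)
  where open ℚᵘ.≃-Reasoning

ι-homo-* : ∀ m n → ι (m * n) ≡ ι m ℚ.* ι n
ι-homo-* m n = toℚᵘ-injective (begin
  toℚᵘ (ι (m * n))              ≈⟨ toℚᵘ-ι (m * n) ⟩
  ιᵘ (m * n)                    ≈⟨ ιᵘ-homo-* m n ⟩
  ιᵘ m ℚᵘ.* ιᵘ n                ≈⟨ ℚᵘ.*-cong (toℚᵘ-ι m) (toℚᵘ-ι n) ⟨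
  toℚᵘ (ι m) ℚᵘ.* toℚᵘ (ι n)    ≈⟨ toℚᵘ-homo-* (ι m) (ι n) ⟨
  toℚᵘ (ι m ℚ.* ι n)            ∎)
  where open ℚᵘ.≃-Reasoning

ι-diamond : ∀ m n p q → ι m ℚ.* ι n ≡ (1ℚ ℚ.+ ι p) ℚ.* (1ℚ ℚ.+ ι q) →
            m * n ≡ suc p * suc q
ι-diamond m n p q eq = ι-injective (begin
  ι (m * n)                       ≡⟨ ι-homo-* m n ⟩
  ι m ℚ.* ι n                     ≡⟨ eq ⟩
  (1ℚ ℚ.+ ι p) ℚ.* (1ℚ ℚ.+ ι q)   ≡⟨ cong₂ ℚ._*_ (ι-homo-+ 1 p) (ι-homo-+ 1 q) ⟨
  ι (suc p) ℚ.* ι (suc q)         ≡⟨ ι-homo-* (suc p) (suc q) ⟨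
  ι (suc p * suc q)               ∎)
  where open ≡-Reasoning

module ArithmeticYFrieze {n y} (arith : IsArithmeticYFrieze n y) where
  open IsArithmeticYFrieze arith
  open IsYFrieze isYFrieze

  entry : ℕ → ℤ → ℕ
  entry i j with 1 ≤? i | i ≤? n
  ... | yes 1≤i | yes i≤n = proj₁ (positiveInteger i j 1≤i i≤n)
  ... | _       | _       = 0

  y≡ι-entry : ∀ {i} → i ≤ suc n → ∀ j → y i j ≡ ι (entry i j)
  y≡ι-entry {i} i≤1+n j with 1 ≤? i | i ≤? n
  ... | yes 1≤i | yes i≤n = proj₂ (proj₂ (positiveInteger i j 1≤i i≤n))
  ... | yes _   | no i≰n with refl ← ≤-antisym i≤1+n (≰⇒> i≰n) = rowTop j
  y≡ι-entry {zero}  _ j | no _   | _ = row0 j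
  y≡ι-entry {suc _} _ j | no 1≰i | _ = contradiction (s≤s z≤n) 1≰i

  y≡ι⇒entry≡ : ∀ {i} → i ≤ suc n → ∀ {j} m → y i j ≡ ι m → entry i j ≡ m
  y≡ι⇒entry≡ i≤1+n {j} m y≡ιm = ι-injective (trans (sym (y≡ι-entry i≤1+n j)) y≡ιm)

  entry-diamond : ∀ {i} → 1 ≤ i → i ≤ n → ∀ j →
                  entry i j * entry i (j ℤ.+ ℤ.1ℤ)
                    ≡ suc (entry (pred i) (j ℤ.+ ℤ.1ℤ)) * suc (entry (suc i) j)
  entry-diamond {i} 1≤i i≤n j =
    ι-diamond (entry i j) (entry i j′) (entry (pred i) j′) (entry (suc i) j) (begin
      ι (entry i j) ℚ.* ι (entry i j′)
        ≡⟨ cong₂ ℚ._*_ (y≡ι-entry i≤1+n j) (y≡ι-entry i≤1+n j′) ⟨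
      y i j ℚ.* y i j′
        ≡⟨ diamond i j 1≤i i≤n ⟩
      (1ℚ ℚ.+ y (pred i) j′) ℚ.* (1ℚ ℚ.+ y (suc i) j)
        ≡⟨ cong₂ (λ s t → (1ℚ ℚ.+ s) ℚ.* (1ℚ ℚ.+ t))
                 (y≡ι-entry (≤-trans pred[n]≤n i≤1+n) j′) (y≡ι-entry (s≤s i≤n) j) ⟩
      (1ℚ ℚ.+ ι (entry (pred i) j′)) ℚ.* (1ℚ ℚ.+ ι (entry (suc i) j)) ∎)
    where
    open ≡-Reasoning
    j′ : ℤ
    j′ = j ℤ.+ ℤ.1ℤ
    i≤1+n : i ≤ suc n
    i≤1+n = m≤n⇒m≤1+n i≤n

m*n≡1+o⇒nonZeroʳ : ∀ m {n o} → m * n ≡ suc o → NonZero n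
m*n≡1+o⇒nonZeroʳ m {zero}  eq = contradiction (trans (sym (*-zeroʳ m)) eq) 0≢1+n
m*n≡1+o⇒nonZeroʳ m {suc n} _  = _

m*n≡o*p∧p≤c*n⇒m≤c*o : ∀ m n o p c .{{_ : NonZero n}} →
                        m * n ≡ o * p → p ≤ c * n → m ≤ c * o
m*n≡o*p∧p≤c*n⇒m≤c*o m n o p c eq p≤cn = *-cancelʳ-≤ m (c * o) n (begin
  m * n        ≡⟨ eq ⟩
  o * p        ≤⟨ *-monoʳ-≤ o p≤cn ⟩
  o * (c * n)  ≡⟨ x*[y*z]≡y*x*z o c n ⟩
  c * o * n    ∎)
  where
  open ≤-Reasoning
  x*[y*z]≡y*x*z : ∀ x y z → x * (y * z) ≡ y * x * z
  x*[y*z]≡y*x*z = solve-∀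

m≤c*[1+n]⇒1+m≤[1+2c]*n : ∀ m c n .{{_ : NonZero n}} →
                           m ≤ c * suc n → suc m ≤ (1 + 2 * c) * n
m≤c*[1+n]⇒1+m≤[1+2c]*n m c (suc n) m≤c*[2+n] = begin
  suc m                          ≤⟨ s≤s m≤c*[2+n] ⟩
  1 + c * (2 + n)                ≤⟨ m≤m+n _ (n + c * n) ⟩
  1 + c * (2 + n) + (n + c * n)  ≡⟨ expand c n ⟩
  (1 + 2 * c) * (1 + n)          ∎
  where
  open ≤-Reasoning
  expand : ∀ c n → 1 + c * (2 + n) + (n + c * n) ≡ (1 + 2 * c) * (1 + n)
  expand = solve-∀

first-row-≤15 : ∀ u₀ u₁ v₀ v₁ w₀ w₁ z₀ z₁ →
                u₀ * u₁ ≡ suc v₀ → v₀ * v₁ ≡ suc u₁ * suc w₀ →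
                w₀ * w₁ ≡ suc v₁ * suc z₀ → z₀ * z₁ ≡ suc w₁ → u₀ ≤ 15
first-row-≤15 u₀ u₁ v₀ v₁ w₀ w₁ z₀ z₁ d₁ d₂ d₃ d₄ =
  m*n≡o*p∧p≤c*n⇒m≤c*o u₀ u₁ 1 (suc v₀) 15 (trans d₁ (sym (*-identityˡ _))) 1+v₀≤15u₁
  where
  instance
    _ : NonZero u₁
    _ = m*n≡1+o⇒nonZeroʳ u₀ d₁
    _ : NonZero v₁
    _ = m*n≡1+o⇒nonZeroʳ v₀ d₂
    _ : NonZero w₁
    _ = m*n≡1+o⇒nonZeroʳ w₀ d₃
    _ : NonZero z₁
    _ = m*n≡1+o⇒nonZeroʳ z₀ d₄
  z₀≤1+w₁ : z₀ ≤ 1 * suc w₁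
  z₀≤1+w₁ = ≤-trans (m≤m*n z₀ z₁) (≤-reflexive (trans d₄ (sym (*-identityˡ _))))
  1+z₀≤3w₁ : suc z₀ ≤ 3 * w₁
  1+z₀≤3w₁ = m≤c*[1+n]⇒1+m≤[1+2c]*n z₀ 1 w₁ z₀≤1+w₁
  1+w₀≤7v₁ : suc w₀ ≤ 7 * v₁
  1+w₀≤7v₁ = m≤c*[1+n]⇒1+m≤[1+2c]*n w₀ 3 v₁
    (m*n≡o*p∧p≤c*n⇒m≤c*o w₀ w₁ (suc v₁) (suc z₀) 3 d₃ 1+z₀≤3w₁)
  1+v₀≤15u₁ : suc v₀ ≤ 15 * u₁
  1+v₀≤15u₁ = m≤c*[1+n]⇒1+m≤[1+2c]*n v₀ 7 u₁
    (m*n≡o*p∧p≤c*n⇒m≤c*o v₀ v₁ (suc u₁) (suc w₀) 7 d₂ 1+w₀≤7v₁)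

last-row-≤15 : ∀ u₀ u₁ v₀ v₁ w₀ w₁ z₀ z₁ →
               u₀ * u₁ ≡ suc v₀ → v₀ * v₁ ≡ suc u₁ * suc w₀ →
               w₀ * w₁ ≡ suc v₁ * suc z₀ → z₀ * z₁ ≡ suc w₁ → z₁ ≤ 15
last-row-≤15 u₀ u₁ v₀ v₁ w₀ w₁ z₀ z₁ d₁ d₂ d₃ d₄ = first-row-≤15 z₁ z₀ w₁ w₀ v₁ v₀ u₁ u₀
  (trans (*-comm z₁ z₀) d₄)
  (trans (*-comm w₁ w₀) (trans d₃ (*-comm (suc v₁) (suc z₀))))
  (trans (*-comm v₁ v₀) (trans d₂ (*-comm (suc u₁) (suc w₀))))
  (trans (*-comm u₁ u₀) d₁)

m∣1+n∧n*o≡p⇒m*o∣o+p : ∀ m n o p → m ∣ suc n → n * o ≡ p → m * o ∣ o + p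
m∣1+n∧n*o≡p⇒m*o∣o+p m n o p m∣1+n n*o≡p =
  subst (m * o ∣_) (cong (λ p → o + p) n*o≡p) (*-monoˡ-∣ o m∣1+n)

m∣r*[1+n]∧n*o≡p⇒m*o∣r*[o+p] : ∀ m n o p r → m ∣ r * suc n → n * o ≡ p →
                                m * o ∣ r * (o + p)
m∣r*[1+n]∧n*o≡p⇒m*o∣r*[o+p] m n o p r m∣r*[1+n] n*o≡p =
  subst (m * o ∣_) (trans (*-assoc r (suc n) o) (cong (λ p → r * (o + p)) n*o≡p))
        (*-monoˡ-∣ o m∣r*[1+n])

DiagonalBound : ℕ → ℕ → ℕ → ℕ → Set
DiagonalBound a b c d = (a ≤ 5 × b ≤ 102 × c ≤ 168 × d ≤ 41)
                      ⊎ (a ≤ 5 × b ≤ 168 × c ≤ 102 × d ≤ 41)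
                      ⊎ (a ≤ 41 × b ≤ 102 × c ≤ 168 × d ≤ 5)
                      ⊎ (a ≤ 41 × b ≤ 168 × c ≤ 102 × d ≤ 5)

diagonalBound? : ∀ a b c d → Dec (DiagonalBound a b c d)
diagonalBound? a b c d = (a ≤? 5 ×-dec b ≤? 102 ×-dec c ≤? 168 ×-dec d ≤? 41)
                   ⊎-dec (a ≤? 5 ×-dec b ≤? 168 ×-dec c ≤? 102 ×-dec d ≤? 41)
                   ⊎-dec (a ≤? 41 ×-dec b ≤? 102 ×-dec c ≤? 168 ×-dec d ≤? 5)
                   ⊎-dec (a ≤? 41 ×-dec b ≤? 168 ×-dec c ≤? 102 ×-dec d ≤? 5)

-- a⁺ = u₁ and d⁻ = z₋₁ are the neighbours of a and d.  With v₁ = (1 + a⁺)(1 + c)/b and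
-- w₋₁ = (1 + b)(1 + d⁻)/c, the four conditions say that a⁺ ∣ 1 + v₁, d⁻ ∣ 1 + w₋₁,
-- c ∣ (1 + d)(1 + v₁) and b ∣ (1 + a)(1 + w₋₁), i.e. that u₂, z₋₂, w₁, v₋₁ are integers,
-- after multiplying through by b or c.
Admissible : (a b c d a⁺ d⁻ : ℕ) → Set
Admissible a b c d a⁺ d⁻ =
  a⁺ * b ∣ b + suc a⁺ * suc c × d⁻ * c ∣ c + suc b * suc d⁻ ×
  c * b ∣ suc d * (b + suc a⁺ * suc c) × b * c ∣ suc a * (c + suc b * suc d⁻)

admissible? : ∀ a b c d a⁺ d⁻ → Dec (Admissible a b c d a⁺ d⁻)
admissible? a b c d a⁺ d⁻ =
  a⁺ * b ∣? b + suc a⁺ * suc c ×-dec d⁻ * c ∣? c + suc b * suc d⁻ ×-dec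
  c * b ∣? suc d * (b + suc a⁺ * suc c) ×-dec b * c ∣? suc a * (c + suc b * suc d⁻)

admissible⇒diagonalBound-search :
  ∀ {a} → a < 16 → ∀ {a⁺} → a⁺ < 16 → ∀ {d⁻} → d⁻ < 16 → ∀ {d} → d < 16 →
  let b = pred (a * a⁺) ; c = pred (d⁻ * d) in
  Admissible a b c d a⁺ d⁻ → DiagonalBound a b c d
admissible⇒diagonalBound-search = toWitness {a? =
  allUpTo? (λ a → allUpTo? (λ a⁺ → allUpTo? (λ d⁻ → allUpTo? (λ d →
    let b = pred (a * a⁺) ; c = pred (d⁻ * d) in
    admissible? a b c d a⁺ d⁻ →-dec diagonalBound? a b c d) 16) 16) 16) 16} _

admissible⇒diagonalBound : ∀ {a b c d a⁺ d⁻} → a ≤ 15 → a⁺ ≤ 15 → d⁻ ≤ 15 → d ≤ 15 →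
                           a * a⁺ ≡ suc b → d⁻ * d ≡ suc c →
                           Admissible a b c d a⁺ d⁻ → DiagonalBound a b c d
admissible⇒diagonalBound a≤15 a⁺≤15 d⁻≤15 d≤15 aa⁺≡1+b d⁻d≡1+c
  with refl ← cong pred aa⁺≡1+b | refl ← cong pred d⁻d≡1+c =
  admissible⇒diagonalBound-search (s≤s a≤15) (s≤s a⁺≤15) (s≤s d⁻≤15) (s≤s d≤15)

-- Rows 1–4 of the frieze.  Positivity is not assumed: every entry divides some 1 + k.
record Frieze₄ (u v w z : ℤ → ℕ) : Set where
  field
    diamond₁ : ∀ j → u j * u (j ℤ.+ ℤ.1ℤ) ≡ suc (v j)
    diamond₂ : ∀ j → v j * v (j ℤ.+ ℤ.1ℤ) ≡ suc (u (j ℤ.+ ℤ.1ℤ)) * suc (w j)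
    diamond₃ : ∀ j → w j * w (j ℤ.+ ℤ.1ℤ) ≡ suc (v (j ℤ.+ ℤ.1ℤ)) * suc (z j)
    diamond₄ : ∀ j → z j * z (j ℤ.+ ℤ.1ℤ) ≡ suc (w (j ℤ.+ ℤ.1ℤ))

  u≤15 : ∀ j → u j ≤ 15
  u≤15 j = first-row-≤15 (u j) (u j′) (v j) (v j′) (w j) (w j′) (z j) (z j′)
    (diamond₁ j) (diamond₂ j) (diamond₃ j) (diamond₄ j)
    where j′ = j ℤ.+ ℤ.1ℤ

  z[1+j]≤15 : ∀ j → z (j ℤ.+ ℤ.1ℤ) ≤ 15
  z[1+j]≤15 j = last-row-≤15 (u j) (u j′) (v j) (v j′) (w j) (w j′) (z j) (z j′)
    (diamond₁ j) (diamond₂ j) (diamond₃ j) (diamond₄ j)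
    where j′ = j ℤ.+ ℤ.1ℤ

  admissible : Admissible (u (+ 0)) (v (+ 0)) (w (+ 0)) (z (+ 0)) (u (+ 1)) (z -[1+ 0 ])
  admissible =
    m∣1+n∧n*o≡p⇒m*o∣o+p a⁺ v₁ b _ a⁺∣1+v₁ v₁b≡[1+a⁺][1+c] ,
    m∣1+n∧n*o≡p⇒m*o∣o+p d⁻ w₋₁ c _ d⁻∣1+w₋₁ w₋₁c≡[1+b][1+d⁻] ,
    m∣r*[1+n]∧n*o≡p⇒m*o∣r*[o+p] c v₁ b _ (suc d) c∣[1+d][1+v₁] v₁b≡[1+a⁺][1+c] ,
    m∣r*[1+n]∧n*o≡p⇒m*o∣r*[o+p] b w₋₁ c _ (suc a) b∣[1+a][1+w₋₁] w₋₁c≡[1+b][1+d⁻]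
    where
    a b c d a⁺ d⁻ v₁ w₋₁ : ℕ
    a = u (+ 0)
    b = v (+ 0)
    c = w (+ 0)
    d = z (+ 0)
    a⁺ = u (+ 1)
    d⁻ = z -[1+ 0 ]
    v₁ = v (+ 1)
    w₋₁ = w -[1+ 0 ]
    v₁b≡[1+a⁺][1+c] : v₁ * b ≡ suc a⁺ * suc c
    v₁b≡[1+a⁺][1+c] = trans (*-comm v₁ b) (diamond₂ (+ 0))
    w₋₁c≡[1+b][1+d⁻] : w₋₁ * c ≡ suc b * suc d⁻
    w₋₁c≡[1+b][1+d⁻] = diamond₃ -[1+ 0 ]
    a⁺∣1+v₁ : a⁺ ∣ suc v₁
    a⁺∣1+v₁ = divides (u (+ 2)) (sym (trans (*-comm (u (+ 2)) a⁺) (diamond₁ (+ 1))))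
    d⁻∣1+w₋₁ : d⁻ ∣ suc w₋₁
    d⁻∣1+w₋₁ = divides (z -[1+ 1 ]) (sym (diamond₄ -[1+ 1 ]))
    c∣[1+d][1+v₁] : c ∣ suc d * suc v₁
    c∣[1+d][1+v₁] = divides (w (+ 1)) (sym (trans (*-comm (w (+ 1)) c)
      (trans (diamond₃ (+ 0)) (*-comm (suc v₁) (suc d)))))
    b∣[1+a][1+w₋₁] : b ∣ suc a * suc w₋₁
    b∣[1+a][1+w₋₁] = divides (v -[1+ 0 ]) (sym (diamond₂ -[1+ 0 ]))

  diagonalBound : DiagonalBound (u (+ 0)) (v (+ 0)) (w (+ 0)) (z (+ 0))
  diagonalBound = admissible⇒diagonalBound
    (u≤15 (+ 0)) (u≤15 (+ 1)) (z[1+j]≤15 -[1+ 1 ]) (z[1+j]≤15 -[1+ 0 ])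
    (diamond₁ (+ 0)) (diamond₄ -[1+ 0 ]) admissible

open ArithmeticYFrieze using (y≡ι⇒entry≡)

frieze₄ : ∀ {y} (arith : IsArithmeticYFrieze 4 y) →
          let open ArithmeticYFrieze arith in
          Frieze₄ (entry 1) (entry 2) (entry 3) (entry 4)
frieze₄ arith = record
  { diamond₁ = λ j → trans (entry-diamond (s≤s z≤n) (≤ᵇ⇒≤ 1 4 _) j) (*-identityˡ _)
  ; diamond₂ = entry-diamond (s≤s z≤n) (≤ᵇ⇒≤ 2 4 _)
  ; diamond₃ = entry-diamond (s≤s z≤n) (≤ᵇ⇒≤ 3 4 _)
  ; diamond₄ = λ j → trans (entry-diamond (s≤s z≤n) (≤ᵇ⇒≤ 4 4 _) j) (*-identityʳ _)
  }
  where
  open ArithmeticYFrieze arith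

lemma3p6 : (y : ℕ → ℤ → ℚ) → IsArithmeticYFrieze 4 y →
    (a b c d : ℕ) →
    y 1 (Data.Integer.+ 0) ≡ (Data.Integer.+ a) / 1 →
    y 2 (Data.Integer.+ 0) ≡ (Data.Integer.+ b) / 1 →
    y 3 (Data.Integer.+ 0) ≡ (Data.Integer.+ c) / 1 →
    y 4 (Data.Integer.+ 0) ≡ (Data.Integer.+ d) / 1 →
    (a ≤ 5 × b ≤ 102 × c ≤ 168 × d ≤ 41)
    ⊎ (a ≤ 5 × b ≤ 168 × c ≤ 102 × d ≤ 41)
    ⊎ (a ≤ 41 × b ≤ 102 × c ≤ 168 × d ≤ 5)
    ⊎ (a ≤ 41 × b ≤ 168 × c ≤ 102 × d ≤ 5)
lemma3p6 y arith a b c d ya yb yc yd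
  with refl ← y≡ι⇒entry≡ arith (≤ᵇ⇒≤ 1 5 _) a ya | refl ← y≡ι⇒entry≡ arith (≤ᵇ⇒≤ 2 5 _) b yb
     | refl ← y≡ι⇒entry≡ arith (≤ᵇ⇒≤ 3 5 _) c yc | refl ← y≡ι⇒entry≡ arith (≤ᵇ⇒≤ 4 5 _) d yd =
  Frieze₄.diagonalBound (frieze₄ arith)
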